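{- Let $(\cdot)^\bullet$ and $(\cdot)^\circ$ be the translations described below. Then: (1) $M =_{\copyright\eta} (M^\circ)^\bullet$ for every term $M$ of $\lambda_{\copyright}$; (2) $(P^\bullet)^\circ =_{ml^*} P$ for every term $P$ of $\lambda_{ml^*}$; (3) $M =_{\copyright\eta} N$ implies $M^\circ =_{ml^*} N^\circ$; (4) $P =_{ml^*} Q$ implies $P^\bullet =_{\copyright\eta} Q^\bullet$.
   Context: The computational core $\lambda_{\copyright}$: values $V,W ::= x \mid \lambda x.M$, computations $M,N,L ::= \,!V \mid VM$ (terms up to $\alpha$-renaming). Rules: $\beta_c$: $(\lambda x.M)(!V) \mapsto M\{V/x\}$; $\mathsf{id}$: $(\lambda x.!x)M \mapsto M$; $\sigma$: $(\lambda y.N)((\lambda x.M)L) \mapsto (\lambda x.(\lambda y.N)M)L$ if $x\notin\mathrm{fv}(N)$; $\eta$: $\lambda x.(V\,!x)\mapsto V$ with $x\notin\mathrm{fv}(V)$. Contexts $C ::= [\,] \mid\, !(\lambda x.C) \mid VC \mid (\lambda x.C)M$; $\to_{\copyright\eta}$ is the contextual closure of $\beta_c\cup\mathsf{id}\cup\sigma\cup\eta$ and $=_{\copyright\eta}$ its reflexive, symmetric, transitive closure. The calculus $\lambda_{ml^*}$: values $V,W ::= x\mid\lambda x.M$, computations $M,N ::= [V] \mid \mathsf{let}\ x=M\ \mathsf{in}\ N \mid VW$; rules: $(\lambda x.M)V\to M\{V/x\}$; $\lambda x.Vx\to V$ ($x\notin\mathrm{fv}(V)$); $\mathsf{let}\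 x=[V]\ \mathsf{in}\ N\to N\{V/x\}$; $\mathsf{let}\ x=M\ \mathsf{in}\ [x]\to M$ ($x\notin\mathrm{fv}(M)$); $\mathsf{let}\ y=(\mathsf{let}\ x=L\ \mathsf{in}\ M)\ \mathsf{in}\ N\to\mathsf{let}\ x=L\ \mathsf{in}\ (\mathsf{let}\ y=M\ \mathsf{in}\ N)$ (bound variables renamed apart, so $x$ not free in $N$); $\to_{ml^*}$ is the contextual closure and $=_{ml^*}$ its reflexive, symmetric, transitive closure. Translation $(\cdot)^\bullet$ from $\lambda_{ml^*}$ to $\lambda_{\copyright}$: $x^\bullet=x$, $(\lambda x.M)^\bullet=\lambda x.M^\bullet$, $(VW)^\bullet=V^\bullet\,!(W^\bullet)$, $[V]^\bullet=!(V^\bullet)$, $(\mathsf{let}\ x=M\ \mathsf{in}\ N)^\bullet=(\lambda x.N^\bullet)M^\bullet$. Translation $(\cdot)^\circ$ from $\lambda_{\copyright}$ to $\lambda_{ml^*}$: $x^\circ=x$, $(\lambda x.M)^\circ=\lambda x.M^\circ$, $(!V)^\circ=[V^\circ]$, $(V\,!W)^\circ=V^\circ W^\circ$, $(xM)^\circ=\mathsf{let}\ y=M^\circ\ \mathsf{in}\ xy$, $((\lambda x.N)M)^\circ=\mathsf{let}\ x=M^\circ\ \mathsf{in}\ N^\circ$, where in the last two clauses $y\notin\mathrm{fv}(M)$ and $M$ is not of the form $!W$. -}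

module Defs where

-- Well-scoped de Bruijn syntax: terms are identified up to alpha-renaming,
-- side conditions "x not free in ..." are expressed by weakening.

open import Data.Nat using (ℕ; zero; suc)
open import Data.Fin using (Fin; zero; suc)
open import Relation.Binary.Construct.Closure.Equivalence using (EqClosure)

mutual
  data Val (n : ℕ) : Set where
    var : Fin n → Val n
    lam : Com (suc n) → Val n

  data Com (n : ℕ) : Set where
    ret : Val n → Com n
    app : Val n → Com n → Com n

Ren : ℕ → ℕ → Set
Ren n m = Fin n → Fin m

ext : ∀ {n m} → Ren n m → Ren (suc n) (suc m)
ext ρ zero    = zero
ext ρ (suc i) = suc (ρ i)

mutual
  renV : ∀ {n m} → Ren n m → Val n → Val m
  renV ρ (var i) = var (ρ i)
  renV ρ (lam M) = lam (renC (ext ρ) M)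

  renC : ∀ {n m} → Ren n m → Com n → Com m
  renC ρ (ret V)   = ret (renV ρ V)
  renC ρ (app V M) = app (renV ρ V) (renC ρ M)

Sub : ℕ → ℕ → Set
Sub n m = Fin n → Val m

exts : ∀ {n m} → Sub n m → Sub (suc n) (suc m)
exts σ zero    = var zero
exts σ (suc i) = renV suc (σ i)

mutual
  subV : ∀ {n m} → Sub n m → Val n → Val m
  subV σ (var i) = σ i
  subV σ (lam M) = lam (subC (exts σ) M)

  subC : ∀ {n m} → Sub n m → Com n → Com m
  subC σ (ret V)   = ret (subV σ V)
  subC σ (app V M) = app (subV σ V) (subC σ M)

sub0 : ∀ {n} → Val n → Sub (suc n) n
sub0 V zero    = V
sub0 V (suc i) = var i

_[_]C : ∀ {n} → Com (suc n) → Val n → Com n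
M [ V ]C = subC (sub0 V) M

mutual
  data _→cV_ {n : ℕ} : Val n → Val n → Set where
    η    : (V : Val n) → lam (app (renV suc V) (ret (var zero))) →cV V
    lamξ : {M M' : Com (suc n)} → M →cC M' → lam M →cV lam M'

  data _→cC_ {n : ℕ} : Com n → Com n → Set where
    βc   : (M : Com (suc n)) (V : Val n) → app (lam M) (ret V) →cC (M [ V ]C)
    idr  : (M : Com n) → app (lam (ret (var zero))) M →cC M
    -- (λy.N)((λx.M)L) ↦ (λx.(λy.N)M)L ; N is weakened past the new x
    σr   : (N : Com (suc n)) (M : Com (suc n)) (L : Com n) →
           app (lam N) (app (lam M) L) →cC
           app (lam (app (lam (renC (ext suc) N)) M)) L
    retξ : {V V' : Val n} → V →cV V' → ret V →cC ret V'
    appξ₁ : {V V' : Val n} {M : Com n} → V →cV V' → app V M →cC app V' M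
    appξ₂ : {V : Val n} {M M' : Com n} → M →cC M' → app V M →cC app V M'

_=cV_ : ∀ {n} → Val n → Val n → Set
_=cV_ = EqClosure _→cV_

_=cC_ : ∀ {n} → Com n → Com n → Set
_=cC_ = EqClosure _→cC_

mutual
  data MVal (n : ℕ) : Set where
    mvar : Fin n → MVal n
    mlam : MCom (suc n) → MVal n

  data MCom (n : ℕ) : Set where
    unit : MVal n → MCom n
    mlet : MCom n → MCom (suc n) → MCom n
    mapp : MVal n → MVal n → MCom n

mutual
  mrenV : ∀ {n m} → Ren n m → MVal n → MVal m
  mrenV ρ (mvar i) = mvar (ρ i)
  mrenV ρ (mlam M) = mlam (mrenC (ext ρ) M)

  mrenC : ∀ {n m} → Ren n m → MCom n → MCom m
  mrenC ρ (unit V)   = unit (mrenV ρ V)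
  mrenC ρ (mlet M N) = mlet (mrenC ρ M) (mrenC (ext ρ) N)
  mrenC ρ (mapp V W) = mapp (mrenV ρ V) (mrenV ρ W)

MSub : ℕ → ℕ → Set
MSub n m = Fin n → MVal m

mexts : ∀ {n m} → MSub n m → MSub (suc n) (suc m)
mexts σ zero    = mvar zero
mexts σ (suc i) = mrenV suc (σ i)

mutual
  msubV : ∀ {n m} → MSub n m → MVal n → MVal m
  msubV σ (mvar i) = σ i
  msubV σ (mlam M) = mlam (msubC (mexts σ) M)

  msubC : ∀ {n m} → MSub n m → MCom n → MCom m
  msubC σ (unit V)   = unit (msubV σ V)
  msubC σ (mlet M N) = mlet (msubC σ M) (msubC (mexts σ) N)
  msubC σ (mapp V W) = mapp (msubV σ V) (msubV σ W)

msub0 : ∀ {n} → MVal n → MSub (suc n) n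
msub0 V zero    = V
msub0 V (suc i) = mvar i

_[_]M : ∀ {n} → MCom (suc n) → MVal n → MCom n
M [ V ]M = msubC (msub0 V) M

mutual
  data _→mV_ {n : ℕ} : MVal n → MVal n → Set where
    ηv    : (V : MVal n) → mlam (mapp (mrenV suc V) (mvar zero)) →mV V
    mlamξ : {M M' : MCom (suc n)} → M →mC M' → mlam M →mV mlam M'

  data _→mC_ {n : ℕ} : MCom n → MCom n → Set where
    βv     : (M : MCom (suc n)) (V : MVal n) → mapp (mlam M) V →mC (M [ V ]M)
    letβ   : (V : MVal n) (N : MCom (suc n)) → mlet (unit V) N →mC (N [ V ]M)
    letη   : (M : MCom n) → mlet M (unit (mvar zero)) →mC M
    -- let y = (let x = L in M) in N ↦ let x = L in (let y = M in N)
    assoc  : (L : MCom n) (M : MCom (suc n)) (N : MCom (suc n)) →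
             mlet (mlet L M) N →mC mlet L (mlet M (mrenC (ext suc) N))
    unitξ  : {V V' : MVal n} → V →mV V' → unit V →mC unit V'
    mletξ₁ : {M M' : MCom n} {N : MCom (suc n)} → M →mC M' → mlet M N →mC mlet M' N
    mletξ₂ : {M : MCom n} {N N' : MCom (suc n)} → N →mC N' → mlet M N →mC mlet M N'
    mappξ₁ : {V V' W : MVal n} → V →mV V' → mapp V W →mC mapp V' W
    mappξ₂ : {V W W' : MVal n} → W →mV W' → mapp V W →mC mapp V W'

_=mV_ : ∀ {n} → MVal n → MVal n → Set
_=mV_ = EqClosure _→mV_

_=mC_ : ∀ {n} → MCom n → MCom n → Set
_=mC_ = EqClosure _→mC_

mutual
  bulV : ∀ {n} → MVal n → Val n
  bulV (mvar i) = var i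
  bulV (mlam M) = lam (bulC M)

  bulC : ∀ {n} → MCom n → Com n
  bulC (unit V)   = ret (bulV V)
  bulC (mlet M N) = app (lam (bulC N)) (bulC M)
  bulC (mapp V W) = app (bulV V) (ret (bulV W))

mutual
  cirV : ∀ {n} → Val n → MVal n
  cirV (var i) = mvar i
  cirV (lam M) = mlam (cirC M)

  cirC : ∀ {n} → Com n → MCom n
  cirC (ret V)                 = unit (cirV V)
  cirC (app V (ret W))         = mapp (cirV V) (cirV W)
  -- (x M)° = let y = M° in x y   (M not of the form !W; y fresh)
  cirC (app (var x) (app W M)) = mlet (cirC (app W M)) (mapp (mvar (suc x)) (mvar zero))
  cirC (app (lam N) (app W M)) = mlet (cirC (app W M)) (cirC N)

module Submission where

-- The translation (·)• is compositional, so it commutes with renaming and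
-- substitution and sends each λml* rule to the λ© rule of the same shape
-- (βv and let-β to βc, let-η to id, assoc to σ, ηv to η).
--
-- (·)° is not compositional, since it treats V !W specially; the key fact is
-- that nevertheless  (V M)° =ml* let y = M° in (body V)  for every M, where
-- body x = x y and body (λx.N) = N° (for M = !W it costs a let-β, and a βv when V is a λ).
-- With it (·)° commutes with substitution up to =ml*, and sends βc to βv,
-- id to let-η, σ to assoc and η to ηv.
--
-- The round trips only differ from the identity at  x M ↦ let y = M° in x y,
-- whose •-image is x M up to one η-step, and at  (let x = M in N)•°, which is
-- the key fact again.

open import Defs
open import Data.Nat using (ℕ; zero; suc)
open import Data.Fin using (Fin; zero; suc)
open import Data.Product using (_×_; _,_)
open import Relation.Binary.PropositionalEquality using (_≡_; refl; sym; trans; cong; cong₂)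
open import Relation.Binary.Structures using (IsEquivalence)
open import Relation.Binary.Construct.Closure.ReflexiveTransitive using (ε; _◅◅_)
open import Relation.Binary.Construct.Closure.Equivalence
  using (EqClosure; gmap; gfold; isEquivalence; return; symmetric)

module _ {A : Set} {R : A → A → Set} where

  return⁻¹ : ∀ {x y} → R y x → EqClosure R x y
  return⁻¹ r = symmetric R (return r)

  ≡⇒EqClosure : ∀ {x y} → x ≡ y → EqClosure R x y
  ≡⇒EqClosure = IsEquivalence.reflexive (isEquivalence R)

module _ {n : ℕ} where

  lam-cong : {M M' : Com (suc n)} → M =cC M' → lam M =cV lam M'
  lam-cong = gmap lam lamξ

  ret-cong : {V V' : Val n} → V =cV V' → ret V =cC ret V'
  ret-cong = gmap ret retξ

  app-cong : {V V' : Val n} {M M' : Com n} → V =cV V' → M =cC M' → app V M =cC app V' M'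
  app-cong {V' = V'} {M = M} p q = gmap (λ V → app V M) appξ₁ p ◅◅ gmap (app V') appξ₂ q

  mlam-cong : {M M' : MCom (suc n)} → M =mC M' → mlam M =mV mlam M'
  mlam-cong = gmap mlam mlamξ

  unit-cong : {V V' : MVal n} → V =mV V' → unit V =mC unit V'
  unit-cong = gmap unit unitξ

  mletˡ-cong : {M M' : MCom n} {N : MCom (suc n)} → M =mC M' → mlet M N =mC mlet M' N
  mletˡ-cong {N = N} = gmap (λ M → mlet M N) mletξ₁

  mletʳ-cong : {M : MCom n} {N N' : MCom (suc n)} → N =mC N' → mlet M N =mC mlet M N'
  mletʳ-cong {M = M} = gmap (mlet M) mletξ₂

  mlet-cong : {M M' : MCom n} {N N' : MCom (suc n)} → M =mC M' → N =mC N' → mlet M N =mC mlet M' N'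
  mlet-cong p q = mletˡ-cong p ◅◅ mletʳ-cong q

  mapp-cong : {V V' W W' : MVal n} → V =mV V' → W =mV W' → mapp V W =mC mapp V' W'
  mapp-cong {V' = V'} {W = W} p q = gmap (λ V → mapp V W) mappξ₁ p ◅◅ gmap (mapp V') mappξ₂ q

mexts-ext : ∀ {n m k} (ρ : Ren n m) (σ : MSub m k) (τ : MSub n k) →
            (∀ i → σ (ρ i) ≡ τ i) → ∀ i → mexts σ (ext ρ i) ≡ mexts τ i
mexts-ext ρ σ τ h zero    = refl
mexts-ext ρ σ τ h (suc i) = cong (mrenV suc) (h i)

mutual
  msubV-mrenV : ∀ {n m k} (ρ : Ren n m) (σ : MSub m k) (τ : MSub n k) →
                (∀ i → σ (ρ i) ≡ τ i) → ∀ V → msubV σ (mrenV ρ V) ≡ msubV τ V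
  msubV-mrenV ρ σ τ h (mvar i) = h i
  msubV-mrenV ρ σ τ h (mlam M) =
    cong mlam (msubC-mrenC (ext ρ) (mexts σ) (mexts τ) (mexts-ext ρ σ τ h) M)

  msubC-mrenC : ∀ {n m k} (ρ : Ren n m) (σ : MSub m k) (τ : MSub n k) →
                (∀ i → σ (ρ i) ≡ τ i) → ∀ M → msubC σ (mrenC ρ M) ≡ msubC τ M
  msubC-mrenC ρ σ τ h (unit V)   = cong unit (msubV-mrenV ρ σ τ h V)
  msubC-mrenC ρ σ τ h (mlet M N) =
    cong₂ mlet (msubC-mrenC ρ σ τ h M)
               (msubC-mrenC (ext ρ) (mexts σ) (mexts τ) (mexts-ext ρ σ τ h) N)
  msubC-mrenC ρ σ τ h (mapp V W) = cong₂ mapp (msubV-mrenV ρ σ τ h V) (msubV-mrenV ρ σ τ h W)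

mexts-id : ∀ {n} (τ : MSub n n) → (∀ i → τ i ≡ mvar i) → ∀ i → mexts τ i ≡ mvar i
mexts-id τ h zero    = refl
mexts-id τ h (suc i) = cong (mrenV suc) (h i)

mutual
  msubV-id : ∀ {n} (τ : MSub n n) → (∀ i → τ i ≡ mvar i) → ∀ V → msubV τ V ≡ V
  msubV-id τ h (mvar i) = h i
  msubV-id τ h (mlam M) = cong mlam (msubC-id (mexts τ) (mexts-id τ h) M)

  msubC-id : ∀ {n} (τ : MSub n n) → (∀ i → τ i ≡ mvar i) → ∀ M → msubC τ M ≡ M
  msubC-id τ h (unit V)   = cong unit (msubV-id τ h V)
  msubC-id τ h (mlet M N) = cong₂ mlet (msubC-id τ h M) (msubC-id (mexts τ) (mexts-id τ h) N)
  msubC-id τ h (mapp V W) = cong₂ mapp (msubV-id τ h V) (msubV-id τ h W)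

mrenC-ext-suc-[mvar-zero] : ∀ {n} (P : MCom (suc n)) → (mrenC (ext suc) P) [ mvar zero ]M ≡ P
mrenC-ext-suc-[mvar-zero] P =
  trans (msubC-mrenC (ext suc) (msub0 (mvar zero)) mvar msub0-ext-suc P) (msubC-id mvar (λ _ → refl) P)
  where
  msub0-ext-suc : ∀ i → msub0 (mvar zero) (ext suc i) ≡ mvar i
  msub0-ext-suc zero    = refl
  msub0-ext-suc (suc i) = refl

mutual
  cirV-renV : ∀ {n m} (ρ : Ren n m) V → cirV (renV ρ V) ≡ mrenV ρ (cirV V)
  cirV-renV ρ (var i) = refl
  cirV-renV ρ (lam M) = cong mlam (cirC-renC (ext ρ) M)

  cirC-renC : ∀ {n m} (ρ : Ren n m) M → cirC (renC ρ M) ≡ mrenC ρ (cirC M)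
  cirC-renC ρ (ret V)                 = cong unit (cirV-renV ρ V)
  cirC-renC ρ (app V (ret W))         = cong₂ mapp (cirV-renV ρ V) (cirV-renV ρ W)
  cirC-renC ρ (app (var x) (app W M)) =
    cong (λ P → mlet P (mapp (mvar (suc (ρ x))) (mvar zero))) (cirC-renC ρ (app W M))
  cirC-renC ρ (app (lam N) (app W M)) = cong₂ mlet (cirC-renC ρ (app W M)) (cirC-renC (ext ρ) N)

cirBody : ∀ {n} → Val n → MCom (suc n)
cirBody (var x) = mapp (mvar (suc x)) (mvar zero)
cirBody (lam N) = cirC N

cirC-app : ∀ {n} (V : Val n) (M : Com n) → cirC (app V M) =mC mlet (cirC M) (cirBody V)
cirC-app (var x) (ret W)   = return⁻¹ (letβ (cirV W) (cirBody (var x)))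
cirC-app (lam N) (ret W)   = return (βv (cirC N) (cirV W)) ◅◅ return⁻¹ (letβ (cirV W) (cirC N))
cirC-app (var x) (app W M) = ε
cirC-app (lam N) (app W M) = ε

mapp-weaken-cirBody : ∀ {n} (W : Val n) → mapp (mrenV suc (cirV W)) (mvar zero) =mC cirBody W
mapp-weaken-cirBody (var y) = ε
mapp-weaken-cirBody (lam N) = return (βv _ _) ◅◅ ≡⇒EqClosure (mrenC-ext-suc-[mvar-zero] (cirC N))

cirV-exts : ∀ {n m} (σ : Sub n m) (τ : MSub n m) → (∀ i → cirV (σ i) ≡ τ i) →
            ∀ i → cirV (exts σ i) ≡ mexts τ i
cirV-exts σ τ h zero    = refl
cirV-exts σ τ h (suc i) = trans (cirV-renV suc (σ i)) (cong (mrenV suc) (h i))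

mutual
  cirV-subV : ∀ {n m} (σ : Sub n m) (τ : MSub n m) → (∀ i → cirV (σ i) ≡ τ i) →
              ∀ V → cirV (subV σ V) =mV msubV τ (cirV V)
  cirV-subV σ τ h (var i) = ≡⇒EqClosure (h i)
  cirV-subV σ τ h (lam N) = mlam-cong (cirC-subC (exts σ) (mexts τ) (cirV-exts σ τ h) N)

  cirC-subC : ∀ {n m} (σ : Sub n m) (τ : MSub n m) → (∀ i → cirV (σ i) ≡ τ i) →
              ∀ M → cirC (subC σ M) =mC msubC τ (cirC M)
  cirC-subC σ τ h (ret V)                 = unit-cong (cirV-subV σ τ h V)
  cirC-subC σ τ h (app V (ret W))         = mapp-cong (cirV-subV σ τ h V) (cirV-subV σ τ h W)
  cirC-subC σ τ h (app (var x) (app W M)) =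
    cirC-app (σ x) (app (subV σ W) (subC σ M)) ◅◅
    mlet-cong (cirC-subC σ τ h (app W M))
              (symmetric _ (mapp-weaken-cirBody (σ x)) ◅◅
               ≡⇒EqClosure (cong (λ V → mapp (mrenV suc V) (mvar zero)) (h x)))
  cirC-subC σ τ h (app (lam N) (app W M)) =
    mlet-cong (cirC-subC σ τ h (app W M)) (cirC-subC (exts σ) (mexts τ) (cirV-exts σ τ h) N)

cirC-[]C : ∀ {n} (M : Com (suc n)) (V : Val n) → cirC (M [ V ]C) =mC (cirC M [ cirV V ]M)
cirC-[]C M V = cirC-subC (sub0 V) (msub0 (cirV V)) cirV-sub0 M
  where
  cirV-sub0 : ∀ i → cirV (sub0 V i) ≡ msub0 (cirV V) i
  cirV-sub0 zero    = refl
  cirV-sub0 (suc i) = refl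

mutual
  cirV-step : ∀ {n} {V V' : Val n} → V →cV V' → cirV V =mV cirV V'
  cirV-step (η V)    =
    ≡⇒EqClosure (cong (λ W → mlam (mapp W (mvar zero))) (cirV-renV suc V)) ◅◅ return (ηv (cirV V))
  cirV-step (lamξ s) = mlam-cong (cirC-step s)

  cirBody-step : ∀ {n} {V V' : Val n} → V →cV V' → cirBody V =mC cirBody V'
  cirBody-step (η (var x)) = ε
  cirBody-step (η (lam P)) =
    ≡⇒EqClosure (cong (λ Q → mapp (mlam Q) (mvar zero)) (cirC-renC (ext suc) P)) ◅◅
    return (βv _ _) ◅◅ ≡⇒EqClosure (mrenC-ext-suc-[mvar-zero] (cirC P))
  cirBody-step (lamξ s)    = cirC-step s

  cirC-step : ∀ {n} {M M' : Com n} → M →cC M' → cirC M =mC cirC M'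
  cirC-step (βc M V)  = return (βv (cirC M) (cirV V)) ◅◅ symmetric _ (cirC-[]C M V)
  cirC-step (idr M)   = cirC-app (lam (ret (var zero))) M ◅◅ return (letη (cirC M))
  -- Both sides unfold, by cirC-app, into let-chains that differ by one assoc step.
  cirC-step (σr N M L) =
    mletˡ-cong (cirC-app (lam M) L) ◅◅ return (assoc (cirC L) (cirC M) (cirC N)) ◅◅
    symmetric _ (cirC-app (lam (app (lam (renC (ext suc) N)) M)) L ◅◅
                 mletʳ-cong (cirC-app (lam (renC (ext suc) N)) M ◅◅
                             ≡⇒EqClosure (cong (mlet (cirC M)) (cirC-renC (ext suc) N))))
  cirC-step (retξ s)  = unit-cong (cirV-step s)
  cirC-step (appξ₁ {V} {V'} {M} s) =
    cirC-app V M ◅◅ mletʳ-cong (cirBody-step s) ◅◅ symmetric _ (cirC-app V' M)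
  cirC-step (appξ₂ {V} {M} {M'} s) =
    cirC-app V M ◅◅ mletˡ-cong (cirC-step s) ◅◅ symmetric _ (cirC-app V M')

mutual
  bulV-mrenV : ∀ {n m} (ρ : Ren n m) V → bulV (mrenV ρ V) ≡ renV ρ (bulV V)
  bulV-mrenV ρ (mvar i) = refl
  bulV-mrenV ρ (mlam M) = cong lam (bulC-mrenC (ext ρ) M)

  bulC-mrenC : ∀ {n m} (ρ : Ren n m) M → bulC (mrenC ρ M) ≡ renC ρ (bulC M)
  bulC-mrenC ρ (unit V)   = cong ret (bulV-mrenV ρ V)
  bulC-mrenC ρ (mlet M N) = cong₂ (λ P Q → app (lam P) Q) (bulC-mrenC (ext ρ) N) (bulC-mrenC ρ M)
  bulC-mrenC ρ (mapp V W) = cong₂ (λ V W → app V (ret W)) (bulV-mrenV ρ V) (bulV-mrenV ρ W)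

bulV-mexts : ∀ {n m} (σ : MSub n m) (τ : Sub n m) → (∀ i → bulV (σ i) ≡ τ i) →
             ∀ i → bulV (mexts σ i) ≡ exts τ i
bulV-mexts σ τ h zero    = refl
bulV-mexts σ τ h (suc i) = trans (bulV-mrenV suc (σ i)) (cong (renV suc) (h i))

mutual
  bulV-msubV : ∀ {n m} (σ : MSub n m) (τ : Sub n m) → (∀ i → bulV (σ i) ≡ τ i) →
               ∀ V → bulV (msubV σ V) ≡ subV τ (bulV V)
  bulV-msubV σ τ h (mvar i) = h i
  bulV-msubV σ τ h (mlam M) = cong lam (bulC-msubC (mexts σ) (exts τ) (bulV-mexts σ τ h) M)

  bulC-msubC : ∀ {n m} (σ : MSub n m) (τ : Sub n m) → (∀ i → bulV (σ i) ≡ τ i) →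
               ∀ M → bulC (msubC σ M) ≡ subC τ (bulC M)
  bulC-msubC σ τ h (unit V)   = cong ret (bulV-msubV σ τ h V)
  bulC-msubC σ τ h (mlet M N) =
    cong₂ (λ P Q → app (lam P) Q) (bulC-msubC (mexts σ) (exts τ) (bulV-mexts σ τ h) N)
                                  (bulC-msubC σ τ h M)
  bulC-msubC σ τ h (mapp V W) =
    cong₂ (λ V W → app V (ret W)) (bulV-msubV σ τ h V) (bulV-msubV σ τ h W)

bulC-[]M : ∀ {n} (N : MCom (suc n)) (V : MVal n) → bulC (N [ V ]M) ≡ bulC N [ bulV V ]C
bulC-[]M N V = bulC-msubC (msub0 V) (sub0 (bulV V)) bulV-msub0 N
  where
  bulV-msub0 : ∀ i → bulV (msub0 V i) ≡ sub0 (bulV V) i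
  bulV-msub0 zero    = refl
  bulV-msub0 (suc i) = refl

mutual
  bulV-step : ∀ {n} {V W : MVal n} → V →mV W → bulV V =cV bulV W
  bulV-step (ηv V)    =
    ≡⇒EqClosure (cong (λ W → lam (app W (ret (var zero)))) (bulV-mrenV suc V)) ◅◅ return (η (bulV V))
  bulV-step (mlamξ s) = lam-cong (bulC-step s)

  bulC-step : ∀ {n} {P Q : MCom n} → P →mC Q → bulC P =cC bulC Q
  bulC-step (βv M V)      = return (βc _ _) ◅◅ ≡⇒EqClosure (sym (bulC-[]M M V))
  bulC-step (letβ V N)    = return (βc _ _) ◅◅ ≡⇒EqClosure (sym (bulC-[]M N V))
  bulC-step (letη M)      = return (idr _)
  bulC-step (assoc L M N) =
    return (σr _ _ _) ◅◅
    ≡⇒EqClosure (cong (λ P → app (lam (app (lam P) (bulC M))) (bulC L)) (sym (bulC-mrenC (ext suc) N)))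
  bulC-step (unitξ s)     = ret-cong (bulV-step s)
  bulC-step (mletξ₁ s)    = app-cong ε (bulC-step s)
  bulC-step (mletξ₂ s)    = app-cong (lam-cong (bulC-step s)) ε
  bulC-step (mappξ₁ s)    = app-cong (bulV-step s) ε
  bulC-step (mappξ₂ s)    = app-cong ε (ret-cong (bulV-step s))

mutual
  bulV-cirV : ∀ {n} (V : Val n) → V =cV bulV (cirV V)
  bulV-cirV (var i) = ε
  bulV-cirV (lam M) = lam-cong (bulC-cirC M)

  bulC-cirC : ∀ {n} (M : Com n) → M =cC bulC (cirC M)
  bulC-cirC (ret V)                 = ret-cong (bulV-cirV V)
  bulC-cirC (app V (ret W))         = app-cong (bulV-cirV V) (ret-cong (bulV-cirV W))
  bulC-cirC (app (var x) (app W M)) = app-cong ε (bulC-cirC (app W M)) ◅◅ return⁻¹ (appξ₁ (η (var x)))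
  bulC-cirC (app (lam N) (app W M)) = app-cong (lam-cong (bulC-cirC N)) (bulC-cirC (app W M))

mutual
  cirV-bulV : ∀ {n} (V : MVal n) → cirV (bulV V) =mV V
  cirV-bulV (mvar i) = ε
  cirV-bulV (mlam M) = mlam-cong (cirC-bulC M)

  cirC-bulC : ∀ {n} (P : MCom n) → cirC (bulC P) =mC P
  cirC-bulC (unit V)   = unit-cong (cirV-bulV V)
  cirC-bulC (mapp V W) = mapp-cong (cirV-bulV V) (cirV-bulV W)
  cirC-bulC (mlet M N) = cirC-app (lam (bulC N)) (bulC M) ◅◅ mlet-cong (cirC-bulC M) (cirC-bulC N)

mainTheorem11 : ((∀ {n} (V : Val n) → V =cV bulV (cirV V)) ×
    (∀ {n} (M : Com n) → M =cC bulC (cirC M))) ×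
    ((∀ {n} (V : MVal n) → cirV (bulV V) =mV V) ×
    (∀ {n} (P : MCom n) → cirC (bulC P) =mC P)) ×
    ((∀ {n} {V W : Val n} → V =cV W → cirV V =mV cirV W) ×
    (∀ {n} {M N : Com n} → M =cC N → cirC M =mC cirC N)) ×
    ((∀ {n} {V W : MVal n} → V =mV W → bulV V =cV bulV W) ×
    (∀ {n} {P Q : MCom n} → P =mC Q → bulC P =cC bulC Q))
mainTheorem11 =
  (bulV-cirV , bulC-cirC) ,
  (cirV-bulV , cirC-bulC) ,
  (gfold (isEquivalence _) cirV cirV-step , gfold (isEquivalence _) cirC cirC-step) ,
  (gfold (isEquivalence _) bulV bulV-step , gfold (isEquivalence _) bulC bulC-step)
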